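{- Let $d \ge 2$ and let $1<b_1 < \cdots < b_d$ be integers. For any integers $r,k \ge 1$, there exist integers $c_2$ with $1 \le c_2 \le b_1^{k(d-2)}$ and $c_j$ with $0\leq c_j\leq c_2$ for $3 \le j \le d$ such that \[ b_d^{ -r} b_2^{rc_2b_1^k} \le b_j^{rc_jb_1^k} \le b_d^r b_2^{r c_2 b_1^k} \] holds for all $2 \le j \le d$. -}

module Defs where

{-# OPTIONS --safe #-}
module Submission where

-- Write B = b₁ᵏ and Nⱼ(c) = ⌊log_{bⱼ} b₂^{cB}⌋ for 3 ≤ j ≤ d.  Among the B^{d-2} + 1
-- exponents c = 0, …, B^{d-2} two, c₀ < c₁, have residue vectors (Nⱼ(c) mod B)ⱼ that
-- agree.  Then c₂ = c₁ - c₀ and cⱼ = (Nⱼ(c₁) - Nⱼ(c₀)) / B work: b₂^{c₂B} is the quotient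
-- of b₂^{c₁B} by b₂^{c₀B}, and bⱼ^{cⱼB} = bⱼ^{Nⱼ(c₁) - Nⱼ(c₀)} is the quotient of the
-- bⱼ-powers just below them, so the two agree up to a factor bⱼ ≤ b_d.  Raising to the
-- r-th power gives the claim.

open import Defs
open import Data.Nat using (ℕ; suc; _+_; _*_; _^_; _∸_; _≤_; _<_)
open import Data.Product using (Σ; _×_; _,_; proj₁; proj₂; map)
open import Data.Nat.Base using (zero; z≤n; s≤s; s≤s⁻¹; z<s; NonZero; >-nonZero)
open import Data.Nat.Properties
open import Data.Nat.DivMod using (_/_; _%_; m%n<n; m≡m%n+[m/n]*n)
open import Data.Fin.Base using (Fin; toℕ; fromℕ<; funToFin; finToFun)
open import Data.Fin.Properties using (pigeonhole; finToFun-funToFin; toℕ-fromℕ<; toℕ<n)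
open import Data.Sum.Base using (inj₁; inj₂)
open import Relation.Binary.PropositionalEquality
  using (_≡_; refl; sym; trans; cong; cong₂; subst; subst₂; module ≡-Reasoning)
open import Relation.Nullary using (yes; no; contradiction)

^-cancelʳ-< : ∀ {β m n} → 1 < β → β ^ m < β ^ n → m < n
^-cancelʳ-< {β@(suc _)} 1<β βᵐ<βⁿ = ≰⇒> λ n≤m → <⇒≱ βᵐ<βⁿ (^-monoʳ-≤ β n≤m)

m%n≡o%n⇒[m/n∸o/n]*n≡m∸o : ∀ m o n .{{_ : NonZero n}} → m % n ≡ o % n →
                          (m / n ∸ o / n) * n ≡ m ∸ o
m%n≡o%n⇒[m/n∸o/n]*n≡m∸o m o n m%n≡o%n = begin
  (m / n ∸ o / n) * n                    ≡⟨ *-distribʳ-∸ n (m / n) (o / n) ⟩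
  m / n * n ∸ o / n * n                  ≡⟨ [m+n]∸[m+o]≡n∸o (o % n) (m / n * n) (o / n * n) ⟨
  o % n + m / n * n ∸ (o % n + o / n * n) ≡⟨ cong₂ (λ u v → u + m / n * n ∸ v)
                                                   (sym m%n≡o%n) (sym (m≡m%n+[m/n]*n o n)) ⟩
  m % n + m / n * n ∸ o                  ≡⟨ cong (_∸ o) (m≡m%n+[m/n]*n m n) ⟨
  m ∸ o                                  ∎
  where open ≡-Reasoning

module _ {d : ℕ} {b : ℕ → ℕ} (increasing : ∀ i → 1 ≤ i → i < d → b i < b (suc i)) where

  increasing⇒monotone : ∀ {i j} → 1 ≤ i → i ≤ j → j ≤ d → b i ≤ b j
  increasing⇒monotone {j = zero}  (s≤s z≤n) () _
  increasing⇒monotone {j = suc j} 1≤i i≤1+j 1+j≤d with m≤n⇒m<n∨m≡n i≤1+j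
  ... | inj₂ refl = ≤-refl
  ... | inj₁ (s≤s i≤j) = ≤-trans (increasing⇒monotone 1≤i i≤j (<⇒≤ 1+j≤d))
                                 (<⇒≤ (increasing j (≤-trans 1≤i i≤j) 1+j≤d))

⌊log[_]_⌋ : ℕ → ℕ → ℕ
⌊log[ β ] zero  ⌋ = 0
⌊log[ β ] suc X ⌋ with suc X <? β ^ suc ⌊log[ β ] X ⌋
... | yes _ = ⌊log[ β ] X ⌋
... | no  _ = suc ⌊log[ β ] X ⌋

⌊log⌋-bounds : ∀ {β X} → 1 < β → 0 < X →
               β ^ ⌊log[ β ] X ⌋ ≤ X × X < β ^ suc ⌊log[ β ] X ⌋
⌊log⌋-bounds {β} {suc zero} 1<β _ with 1 <? β ^ 1
... | yes 1<β¹ = ≤-refl , 1<β¹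
... | no  1≮β¹ = contradiction (≤-trans 1<β (≤-reflexive (sym (*-identityʳ β)))) 1≮β¹
⌊log⌋-bounds {β} {suc (suc X)} 1<β _
  with ⌊log⌋-bounds {X = suc X} 1<β z<s | suc (suc X) <? β ^ suc ⌊log[ β ] suc X ⌋
... | lower , _     | yes below  = ≤-trans lower (n≤1+n (suc X)) , below
... | _     , upper | no  ¬below =
  ≮⇒≥ ¬below , ≤-<-trans upper (^-monoʳ-< β 1<β (n<1+n (suc ⌊log[ β ] suc X ⌋)))

⌊log⌋-mono-≤ : ∀ {β X Y} → 1 < β → 0 < X → X ≤ Y → ⌊log[ β ] X ⌋ ≤ ⌊log[ β ] Y ⌋
⌊log⌋-mono-≤ {β} {X} {Y} 1<β 0<X X≤Y = s≤s⁻¹ (^-cancelʳ-< 1<β (begin-strict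
  β ^ ⌊log[ β ] X ⌋      ≤⟨ proj₁ (⌊log⌋-bounds 1<β 0<X) ⟩
  X                      ≤⟨ X≤Y ⟩
  Y                      <⟨ proj₂ (⌊log⌋-bounds 1<β (<-≤-trans 0<X X≤Y)) ⟩
  β ^ suc ⌊log[ β ] Y ⌋  ∎))
  where open ≤-Reasoning

⌊log⌋-quotient : ∀ {β X Y Z} → 1 < β → 0 < X → 0 < Z → Z * X ≡ Y →
                 let D = ⌊log[ β ] Y ⌋ ∸ ⌊log[ β ] X ⌋ in Z < β * β ^ D × β ^ D < β * Z
⌊log⌋-quotient {β} {X} {Y} {Z} 1<β 0<X 0<Z Z*X≡Y = Z<β*βᴰ , βᴰ<β*Z
  where
  open ≤-Reasoning
  instance
    Z≢0 : NonZero Z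
    Z≢0 = >-nonZero 0<Z
  n m D : ℕ
  n = ⌊log[ β ] X ⌋
  m = ⌊log[ β ] Y ⌋
  D = m ∸ n
  X≤Y : X ≤ Y
  X≤Y = subst (X ≤_) Z*X≡Y (m≤n*m X Z)
  βᵐ≡βᴰ*βⁿ : β ^ m ≡ β ^ D * β ^ n
  βᵐ≡βᴰ*βⁿ = trans (cong (β ^_) (sym (m∸n+n≡m (⌊log⌋-mono-≤ 1<β 0<X X≤Y)))) (^-distribˡ-+-* β D n)
  Z<β*βᴰ : Z < β * β ^ D
  Z<β*βᴰ = *-cancelʳ-< (β ^ n) Z (β * β ^ D) (begin-strict
    Z * β ^ n            ≤⟨ *-monoʳ-≤ Z (proj₁ (⌊log⌋-bounds 1<β 0<X)) ⟩
    Z * X                ≡⟨ Z*X≡Y ⟩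
    Y                    <⟨ proj₂ (⌊log⌋-bounds 1<β (<-≤-trans 0<X X≤Y)) ⟩
    β * β ^ m            ≡⟨ cong (β *_) βᵐ≡βᴰ*βⁿ ⟩
    β * (β ^ D * β ^ n)  ≡⟨ *-assoc β (β ^ D) (β ^ n) ⟨
    β * β ^ D * β ^ n    ∎)
  βᴰ<β*Z : β ^ D < β * Z
  βᴰ<β*Z = *-cancelʳ-< (β ^ n) (β ^ D) (β * Z) (begin-strict
    β ^ D * β ^ n        ≡⟨ βᵐ≡βᴰ*βⁿ ⟨
    β ^ m                ≤⟨ proj₁ (⌊log⌋-bounds 1<β (<-≤-trans 0<X X≤Y)) ⟩
    Y                    ≡⟨ Z*X≡Y ⟨
    Z * X                <⟨ *-monoʳ-< Z (proj₂ (⌊log⌋-bounds 1<β 0<X)) ⟩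
    Z * (β * β ^ n)      ≡⟨ *-assoc Z β (β ^ n) ⟨
    Z * β * β ^ n        ≡⟨ cong (_* β ^ n) (*-comm Z β) ⟩
    β * Z * β ^ n        ∎)

WithinFactor : ℕ → ℕ → ℕ → Set
WithinFactor w x y = x ≤ w * y × y ≤ w * x

WithinFactor-refl : ∀ w .{{_ : NonZero w}} x → WithinFactor w x x
WithinFactor-refl w x = m≤n*m x w , m≤n*m x w

WithinFactor-mono : ∀ {w w′ x y} → w ≤ w′ → WithinFactor w x y → WithinFactor w′ x y
WithinFactor-mono {x = x} {y = y} w≤w′ = map (λ x≤wy → ≤-trans x≤wy (*-monoˡ-≤ y w≤w′))
                                             (λ y≤wx → ≤-trans y≤wx (*-monoˡ-≤ x w≤w′))

WithinFactor-^ : ∀ {w x y} r → WithinFactor w x y → WithinFactor (w ^ r) (x ^ r) (y ^ r)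
WithinFactor-^ r = map (power r) (power r)
  where
  power : ∀ {w x y} r → x ≤ w * y → x ^ r ≤ w ^ r * y ^ r
  power zero    _      = ≤-refl
  power {w} {x} {y} (suc r) x≤wy = begin
    x * x ^ r                ≤⟨ *-mono-≤ x≤wy (power r x≤wy) ⟩
    w * y * (w ^ r * y ^ r)  ≡⟨ [m*n]*[o*p]≡[m*o]*[n*p] w y (w ^ r) (y ^ r) ⟩
    w * w ^ r * (y * y ^ r)  ∎
    where open ≤-Reasoning

WithinFactor-^-scale : ∀ {w w′ x y} B c c′ r → w ≤ w′ →
  WithinFactor w (x ^ (c * B)) (y ^ (c′ * B)) →
  WithinFactor (w′ ^ r) (x ^ (r * c * B)) (y ^ (r * c′ * B))
WithinFactor-^-scale {w′ = w′} {x} {y} B c c′ r w≤w′ close =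
  subst₂ (WithinFactor (w′ ^ r)) (rescale x c) (rescale y c′)
    (WithinFactor-mono (^-monoˡ-≤ r w≤w′) (WithinFactor-^ r close))
  where
  rescale : ∀ z e → (z ^ (e * B)) ^ r ≡ z ^ (r * e * B)
  rescale z e =
    trans (^-*-assoc z (e * B) r) (cong (z ^_) (trans (*-comm (e * B) r) (sym (*-assoc r e B))))

commensurable-powers :
  ∀ {α β} B .{{_ : NonZero B}} → 1 < β → 0 < α → α ≤ β → ∀ {c₀ c₁} → c₀ ≤ c₁ →
  ⌊log[ β ] α ^ (c₀ * B) ⌋ % B ≡ ⌊log[ β ] α ^ (c₁ * B) ⌋ % B →
  let c = ⌊log[ β ] α ^ (c₁ * B) ⌋ / B ∸ ⌊log[ β ] α ^ (c₀ * B) ⌋ / B in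
  c ≤ c₁ ∸ c₀ × WithinFactor β (α ^ ((c₁ ∸ c₀) * B)) (β ^ (c * B))
commensurable-powers {α} {β} B 1<β 0<α α≤β {c₀} {c₁} c₀≤c₁ same-residue =
  c≤c₁∸c₀ , map <⇒≤ <⇒≤ quotient
  where
  instance
    α≢0 : NonZero α
    α≢0 = >-nonZero 0<α
  n₀ n₁ c Z : ℕ
  n₀ = ⌊log[ β ] α ^ (c₀ * B) ⌋
  n₁ = ⌊log[ β ] α ^ (c₁ * B) ⌋
  c = n₁ / B ∸ n₀ / B
  Z = α ^ ((c₁ ∸ c₀) * B)
  Z*α^c₀B≡α^c₁B : Z * α ^ (c₀ * B) ≡ α ^ (c₁ * B)
  Z*α^c₀B≡α^c₁B = begin
    Z * α ^ (c₀ * B)               ≡⟨ ^-distribˡ-+-* α ((c₁ ∸ c₀) * B) (c₀ * B) ⟨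
    α ^ ((c₁ ∸ c₀) * B + c₀ * B)   ≡⟨ cong (α ^_) (*-distribʳ-+ B (c₁ ∸ c₀) c₀) ⟨
    α ^ ((c₁ ∸ c₀ + c₀) * B)       ≡⟨ cong (λ t → α ^ (t * B)) (m∸n+n≡m c₀≤c₁) ⟩
    α ^ (c₁ * B)                   ∎
    where open ≡-Reasoning
  quotient : Z < β * β ^ (c * B) × β ^ (c * B) < β * Z
  quotient = subst (λ t → Z < β * β ^ t × β ^ t < β * Z)
               (sym (m%n≡o%n⇒[m/n∸o/n]*n≡m∸o n₁ n₀ B (sym same-residue)))
               (⌊log⌋-quotient 1<β (m^n>0 α (c₀ * B)) (m^n>0 α ((c₁ ∸ c₀) * B)) Z*α^c₀B≡α^c₁B)
  c≤c₁∸c₀ : c ≤ c₁ ∸ c₀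
  c≤c₁∸c₀ = *-cancelʳ-≤ c (c₁ ∸ c₀) B (s≤s⁻¹ (^-cancelʳ-< 1<β (begin-strict
    β ^ (c * B)               <⟨ proj₂ quotient ⟩
    β * Z                     ≤⟨ *-monoʳ-≤ β (^-monoˡ-≤ ((c₁ ∸ c₀) * B) α≤β) ⟩
    β * β ^ ((c₁ ∸ c₀) * B)   ∎)))
    where open ≤-Reasoning

record ResidueCollision (m n : ℕ) .{{_ : NonZero m}} (f : ℕ → ℕ → ℕ) : Set where
  field
    c₀ c₁ : ℕ
    c₀<c₁ : c₀ < c₁
    c₁≤mⁿ : c₁ ≤ m ^ n
    agree : ∀ i → i < n → f c₀ i % m ≡ f c₁ i % m

module _ (m n : ℕ) .{{_ : NonZero m}} (f : ℕ → ℕ → ℕ) where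

  private
    residues : ℕ → Fin n → Fin m
    residues c i = fromℕ< (m%n<n (f c (toℕ i)) m)

    code : Fin (suc (m ^ n)) → Fin (m ^ n)
    code c = funToFin (residues (toℕ c))

    same-code⇒same-residues : ∀ {c c′} → code c ≡ code c′ →
                              ∀ i → f (toℕ c) (toℕ i) % m ≡ f (toℕ c′) (toℕ i) % m
    same-code⇒same-residues {c} {c′} same-code i = begin
      f (toℕ c) (toℕ i) % m       ≡⟨ toℕ-fromℕ< _ ⟨
      toℕ (residues (toℕ c) i)    ≡⟨ cong toℕ (finToFun-funToFin (residues (toℕ c)) i) ⟨
      toℕ (finToFun (code c) i)   ≡⟨ cong (λ v → toℕ (finToFun v i)) same-code ⟩
      toℕ (finToFun (code c′) i)  ≡⟨ cong toℕ (finToFun-funToFin (residues (toℕ c′)) i) ⟩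
      toℕ (residues (toℕ c′) i)   ≡⟨ toℕ-fromℕ< _ ⟩
      f (toℕ c′) (toℕ i) % m      ∎
      where open ≡-Reasoning

  residue-pigeonhole : ResidueCollision m n f
  residue-pigeonhole with c₀ , c₁ , c₀<c₁ , same-code ← pigeonhole (n<1+n (m ^ n)) code = record
    { c₀ = toℕ c₀ ; c₁ = toℕ c₁ ; c₀<c₁ = c₀<c₁ ; c₁≤mⁿ = s≤s⁻¹ (toℕ<n c₁)
    ; agree = λ i i<n → subst (λ t → f (toℕ c₀) t % m ≡ f (toℕ c₁) t % m)
                              (toℕ-fromℕ< i<n) (same-code⇒same-residues same-code (fromℕ< i<n)) }

proposition2p4 : (d : ℕ) → 2 ≤ d → (b : ℕ → ℕ) → 1 < b 1 →
    (∀ i → 1 ≤ i → i < d → b i < b (suc i)) →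
    (r k : ℕ) → 1 ≤ r → 1 ≤ k →
    Σ (ℕ → ℕ) λ c → ((1 ≤ c 2 × c 2 ≤ b 1 ^ (k * (d ∸ 2)))
      × (∀ j → 3 ≤ j → j ≤ d → c j ≤ c 2)
      × (∀ j → 2 ≤ j → j ≤ d →
           (b 2 ^ (r * c 2 * b 1 ^ k) ≤ b d ^ r * b j ^ (r * c j * b 1 ^ k))
           × (b j ^ (r * c j * b 1 ^ k) ≤ b d ^ r * b 2 ^ (r * c 2 * b 1 ^ k))))
proposition2p4 d@(suc (suc e)) (s≤s (s≤s z≤n)) b 1<b₁ increasing r k _ _ =
  c , (m<n⇒0<n∸m c₀<c₁ , c₂≤b₁^[k*e]) , c≤c₂ , close
  where
  B : ℕ
  B = b 1 ^ k
  instance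
    b₁≢0 : NonZero (b 1)
    b₁≢0 = >-nonZero (<-trans z<s 1<b₁)
    B≢0 : NonZero B
    B≢0 = m^n≢0 (b 1) k
  open ResidueCollision (residue-pigeonhole B e λ c i → ⌊log[ b (3 + i) ] b 2 ^ (c * B) ⌋)

  c : ℕ → ℕ
  c 2 = c₁ ∸ c₀
  c j = ⌊log[ b j ] b 2 ^ (c₁ * B) ⌋ / B ∸ ⌊log[ b j ] b 2 ^ (c₀ * B) ⌋ / B

  c₂≤b₁^[k*e] : c 2 ≤ b 1 ^ (k * e)
  c₂≤b₁^[k*e] = ≤-trans (m∸n≤m c₁ c₀) (≤-trans c₁≤mⁿ (≤-reflexive (^-*-assoc (b 1) k e)))

  b-mono : ∀ {i j} → 1 ≤ i → i ≤ j → j ≤ d → b i ≤ b j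
  b-mono = increasing⇒monotone increasing

  1<b₂ : 1 < b 2
  1<b₂ = <-trans 1<b₁ (increasing 1 (s≤s z≤n) (s≤s (s≤s z≤n)))

  instance
    b-d≢0 : NonZero (b d)
    b-d≢0 = >-nonZero (<-≤-trans (<-trans z<s 1<b₁) (b-mono (s≤s z≤n) (s≤s z≤n) ≤-refl))

  c₃₊ᵢ-commensurable : ∀ i → 3 + i ≤ d →
    c (3 + i) ≤ c 2 × WithinFactor (b (3 + i)) (b 2 ^ (c 2 * B)) (b (3 + i) ^ (c (3 + i) * B))
  c₃₊ᵢ-commensurable i 3+i≤d = commensurable-powers B (<-≤-trans 1<b₂ b₂≤b₃₊ᵢ) (<-trans z<s 1<b₂)
    b₂≤b₃₊ᵢ (<⇒≤ c₀<c₁) (agree i (s≤s⁻¹ (s≤s⁻¹ 3+i≤d)))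
    where
    b₂≤b₃₊ᵢ : b 2 ≤ b (3 + i)
    b₂≤b₃₊ᵢ = b-mono (s≤s z≤n) (s≤s (s≤s z≤n)) 3+i≤d

  c≤c₂ : ∀ j → 3 ≤ j → j ≤ d → c j ≤ c 2
  c≤c₂ _ (s≤s (s≤s (s≤s _))) j≤d = proj₁ (c₃₊ᵢ-commensurable _ j≤d)

  close : ∀ j → 2 ≤ j → j ≤ d → WithinFactor (b d ^ r) (b 2 ^ (r * c 2 * B)) (b j ^ (r * c j * B))
  close 2 (s≤s (s≤s z≤n)) _ = WithinFactor-refl (b d ^ r) {{m^n≢0 (b d) r}} _
  close (suc (suc (suc i))) (s≤s (s≤s z≤n)) j≤d = WithinFactor-^-scale B (c 2) (c (3 + i)) r
    (b-mono (s≤s z≤n) j≤d ≤-refl) (proj₂ (c₃₊ᵢ-commensurable i j≤d))
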